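{- For every integer $n \geq 2$, the independence number of the edge-clique graph of the cocktail party graph $cp(n)$ satisfies $\alpha(K_e(cp(n))) = 4$.
   Context: The cocktail party graph $cp(n)$ is the complement of a perfect matching on $2n$ vertices, i.e. the graph on vertices $x_1,\dots,x_n,y_1,\dots,y_n$ in which every pair is adjacent except the pairs $\{x_i,y_i\}$. For a graph $G$, the edge-clique graph $K_e(G)$ has as its vertices the edges of $G$, and two distinct vertices of $K_e(G)$ are adjacent when the corresponding two edges of $G$ are contained in a common clique of $G$ (equivalently, their endpoints together induce a complete subgraph of $G$). $\alpha(\cdot)$ denotes the independence number. -}

module Defs where

open import Level using (0ℓ)
open import Data.Nat using (ℕ; _≤_)
open import Data.Fin using (Fin)
open import Data.Bool using (Bool)
open import Data.Product using (Σ; _×_; _,_; ∃)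
open import Data.Sum using (_⊎_)
open import Data.List using (List; []; _∷_; length)
open import Data.List.Membership.Propositional using (_∈_)
open import Data.List.Relation.Unary.AllPairs using (AllPairs)
open import Relation.Nullary using (¬_)
open import Relation.Binary.PropositionalEquality using (_≡_; _≢_)

-- A (simple, undirected) graph: a type of vertices, a notion of vertex
-- identity _≈_ (propositional equality for concrete graphs, "same unordered
-- pair" for edge-clique graphs) and an adjacency relation.
record Graph : Set₁ where
  field
    V   : Set
    _≈_ : V → V → Set
    _~_ : V → V → Set

open Graph public

IndependentSet : (G : Graph) → List (V G) → Set
IndependentSet G = AllPairs (λ a b → ¬ (_≈_ G a b) × ¬ (_~_ G a b))

IndependenceNumberIs : Graph → ℕ → Set
IndependenceNumberIs G k =
  (Σ (List (V G)) λ S → IndependentSet G S × length S ≡ k)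
  × (∀ (S : List (V G)) → IndependentSet G S → length S ≤ k)

-- Cocktail party graph cp(n): vertices x_i = (i , true), y_i = (i , false);
-- two vertices are adjacent iff they have different indices (so the only
-- non-adjacent pairs of distinct vertices are {x_i , y_i}).
cp : ℕ → Graph
cp n = record
  { V   = Fin n × Bool
  ; _≈_ = _≡_
  ; _~_ = λ { (i , _) (j , _) → i ≢ j }
  }

-- Edges of a graph G whose vertex identity is _≡_, as ordered pairs of
-- adjacent vertices; the two orientations represent the same edge.
Edge : Graph → Set
Edge G = Σ (V G × V G) λ { (u , v) → _~_ G u v }

SameEdge : (G : Graph) → Edge G → Edge G → Set
SameEdge G ((u , v) , _) ((u' , v') , _) =
  (u ≡ u' × v ≡ v') ⊎ (u ≡ v' × v ≡ u')

IsComplete : (G : Graph) → List (V G) → Set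
IsComplete G S = ∀ {a b} → a ∈ S → b ∈ S → a ≢ b → _~_ G a b

Ke : Graph → Graph
Ke G = record
  { V   = Edge G
  ; _≈_ = SameEdge G
  ; _~_ = λ e f → ¬ SameEdge G e f ×
            IsComplete G (ends e Data.List.++ ends f)
  }
  where
    ends : Edge G → List (V G)
    ends ((u , v) , _) = u ∷ v ∷ []

module Submission where

-- Read a vertex (i , b) of cp(n) as a literal over the variable i, with
-- x_i = (i , true) and y_i = (i , false) complementary.  An edge of cp(n) is
-- then a pair of literals over two different variables, and the endpoints of
-- two edges fail to span a clique exactly when the edges CLASH: one contains
-- a literal, the other its complement.  So an independent set of K_e(cp(n))
-- is a family of distinct, pairwise clashing edges.
--
-- Lower bound: over two fixed variables i ≠ j the four edges {i^s , j^t}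
-- (s , t ∈ Bool) pairwise clash.  Upper bound: five pairwise clashing edges
-- are impossible.  Each edge clashing with e₁ = {a , b} contains ¬a or ¬b,
-- so among the other four, either three share one literal (excluded by
-- 'no-three-through') or two contain ¬a and two contain ¬b (excluded by
-- 'no-two-pairs').  Both exclusions rest on 'shared-endpoint': two clashing
-- edges through a common literal have complementary other endpoints.

open import Defs
open import Data.Nat using (ℕ; _≤_; suc; z≤n; s≤s)
open import Data.Fin using (Fin; zero; suc)
import Data.Fin.Properties as Fin
open import Data.Bool using (Bool; true; false; not)
import Data.Bool.Properties as Bool
open import Data.Product using (Σ; _×_; _,_; proj₁)
open import Data.Product.Properties using (≡-dec)
open import Data.Sum using (_⊎_; inj₁; inj₂)
import Data.Sum as Sum
open import Data.List using (List; []; _∷_; length)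
open import Data.List.Relation.Unary.Any using (here; there)
open import Data.List.Relation.Unary.All using ([]; _∷_)
open import Data.List.Relation.Unary.AllPairs using ([]; _∷_)
open import Data.List.Membership.Propositional using (_∈_)
open import Data.Empty using (⊥; ⊥-elim)
open import Function using (_∘_)
open import Relation.Nullary using (¬_; Dec; yes; no)
open import Relation.Binary.PropositionalEquality

module CocktailParty (n : ℕ) where

  Literal : Set
  Literal = Fin n × Bool

  var : Literal → Fin n
  var = proj₁

  neg : Literal → Literal
  neg (i , b) = i , not b

  neg-involutive : ∀ x → neg (neg x) ≡ x
  neg-involutive (i , b) = cong (i ,_) (Bool.not-involutive b)

  neg-irreflexive : ∀ x → neg x ≢ x
  neg-irreflexive (i , true) ()
  neg-irreflexive (i , false) ()

  neg-flip : ∀ {x y} → neg x ≡ y → x ≡ neg y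
  neg-flip {x} refl = sym (neg-involutive x)

  _≟_ : (x y : Literal) → Dec (x ≡ y)
  _≟_ = ≡-dec Fin._≟_ Bool._≟_

  same-var : ∀ x y → var x ≡ var y → x ≢ y → y ≡ neg x
  same-var (i , true) (.i , true) refl x≢y = ⊥-elim (x≢y refl)
  same-var (i , true) (.i , false) refl _ = refl
  same-var (i , false) (.i , true) refl _ = refl
  same-var (i , false) (.i , false) refl x≢y = ⊥-elim (x≢y refl)

  CPEdge : Set
  CPEdge = Edge (cp n)

  Same : CPEdge → CPEdge → Set
  Same = SameEdge (cp n)

  data _∈ₑ_ (x : Literal) : CPEdge → Set where
    first  : ∀ {y x≁y} → x ∈ₑ ((x , y) , x≁y)
    second : ∀ {y y≁x} → x ∈ₑ ((y , x) , y≁x)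

  _∈ₑ?_ : ∀ x C → Dec (x ∈ₑ C)
  x ∈ₑ? ((u , v) , _) with x ≟ u | x ≟ v
  ... | yes refl | _ = yes first
  ... | no _ | yes refl = yes second
  ... | no x≢u | no x≢v = no λ { first → x≢u refl ; second → x≢v refl }

  endpoint-by-var : ∀ {C x y} → x ∈ₑ C → y ∈ₑ C → var x ≡ var y → x ≡ y
  endpoint-by-var first first _ = refl
  endpoint-by-var second second _ = refl
  endpoint-by-var (first {x≁y = x≁y}) second eq = ⊥-elim (x≁y eq)
  endpoint-by-var (second {y≁x = y≁x}) first eq = ⊥-elim (y≁x (sym eq))

  no-complementary-endpoints : ∀ {C x} → x ∈ₑ C → ¬ neg x ∈ₑ C
  no-complementary-endpoints {x = x} x∈C ¬x∈C =
    neg-irreflexive x (endpoint-by-var ¬x∈C x∈C refl)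

  Covers : CPEdge → Literal → Literal → Set
  Covers C p q = ∀ {x} → x ∈ₑ C → x ≡ p ⊎ x ≡ q

  covered-by : ∀ {C p q} → p ∈ₑ C → q ∈ₑ C → var p ≢ var q → Covers C p q
  covered-by first  second _ first  = inj₁ refl
  covered-by first  second _ second = inj₂ refl
  covered-by second first  _ first  = inj₂ refl
  covered-by second first  _ second = inj₁ refl
  covered-by first  first  p≁q _ = ⊥-elim (p≁q refl)
  covered-by second second p≁q _ = ⊥-elim (p≁q refl)

  other-endpoint : ∀ {C p} → p ∈ₑ C → Σ Literal λ q → q ∈ₑ C × var p ≢ var q
  other-endpoint (first {x≁y = p≁q}) = _ , second , p≁q
  other-endpoint (second {y≁x = q≁p}) = _ , first , q≁p ∘ sym

  edge-determined : ∀ {C D p q} → p ∈ₑ C → q ∈ₑ C → p ∈ₑ D → q ∈ₑ D →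
                    var p ≢ var q → Same C D
  edge-determined first  second first  second _ = inj₁ (refl , refl)
  edge-determined first  second second first  _ = inj₂ (refl , refl)
  edge-determined second first  first  second _ = inj₂ (refl , refl)
  edge-determined second first  second first  _ = inj₁ (refl , refl)
  edge-determined first  first  _ _ p≁q = ⊥-elim (p≁q refl)
  edge-determined second second _ _ p≁q = ⊥-elim (p≁q refl)
  edge-determined _ _ first  first  p≁q = ⊥-elim (p≁q refl)
  edge-determined _ _ second second p≁q = ⊥-elim (p≁q refl)

  -- Clashing edges: a literal of C is complemented in D.  For distinct edges
  -- this is exactly non-adjacency in K_e(cp(n)) ('independent⇒conflict').
  Clash : CPEdge → CPEdge → Set
  Clash C D = Σ Literal λ x → x ∈ₑ C × neg x ∈ₑ D

  clash-sym : ∀ {C D} → Clash C D → Clash D C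
  clash-sym {C} (x , x∈C , ¬x∈D) =
    neg x , ¬x∈D , subst (_∈ₑ C) (sym (neg-involutive x)) x∈C

  clash? : ∀ C D → Dec (Clash C D)
  clash? ((u , v) , _) D with neg u ∈ₑ? D | neg v ∈ₑ? D
  ... | yes ¬u∈D | _ = yes (u , first , ¬u∈D)
  ... | no _ | yes ¬v∈D = yes (v , second , ¬v∈D)
  ... | no ¬u∉D | no ¬v∉D = no λ
    { (_ , first , ¬u∈D) → ¬u∉D ¬u∈D
    ; (_ , second , ¬v∈D) → ¬v∉D ¬v∈D }

  clash-from : ∀ {a b a≁b} D → Clash ((a , b) , a≁b) D → neg a ∈ₑ D ⊎ neg b ∈ₑ D
  clash-from D (_ , first , ¬a∈D) = inj₁ ¬a∈D
  clash-from D (_ , second , ¬b∈D) = inj₂ ¬b∈D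

  record Conflict (C D : CPEdge) : Set where
    field
      distinct : ¬ Same C D
      clash    : Clash C D

  open Conflict

  clash-through : ∀ {C D p q} → Clash C D → Covers C p q → ¬ neg p ∈ₑ D → neg q ∈ₑ D
  clash-through (x , x∈C , ¬x∈D) cover ¬p∉D with cover x∈C
  ... | inj₁ refl = ⊥-elim (¬p∉D ¬x∈D)
  ... | inj₂ refl = ¬x∈D

  shared-endpoint : ∀ {C D ℓ o} → ℓ ∈ₑ C → ℓ ∈ₑ D → Clash C D →
                    o ∈ₑ C → var ℓ ≢ var o → neg o ∈ₑ D
  shared-endpoint ℓ∈C ℓ∈D C×D o∈C ℓ≁o =
    clash-through C×D (covered-by ℓ∈C o∈C ℓ≁o) (no-complementary-endpoints ℓ∈D)

  -- Hence no three pairwise conflicting edges pass through one literal: the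
  -- last two would both be {ℓ , ¬o}.
  no-three-through : ∀ {ℓ C₁ C₂ C₃} → ℓ ∈ₑ C₁ → ℓ ∈ₑ C₂ → ℓ ∈ₑ C₃ →
                     Clash C₁ C₂ → Clash C₁ C₃ → ¬ Same C₂ C₃ → ⊥
  no-three-through ℓ∈C₁ ℓ∈C₂ ℓ∈C₃ C₁×C₂ C₁×C₃ C₂≠C₃
    with other-endpoint ℓ∈C₁
  ... | o , o∈C₁ , ℓ≁o =
    C₂≠C₃ (edge-determined ℓ∈C₂ (shared-endpoint ℓ∈C₁ ℓ∈C₂ C₁×C₂ o∈C₁ ℓ≁o)
                                  ℓ∈C₃ (shared-endpoint ℓ∈C₁ ℓ∈C₃ C₁×C₃ o∈C₁ ℓ≁o) ℓ≁o)

  lands-on : ∀ {P D β δ} → Covers D β δ → ¬ neg β ∈ₑ P → Clash P D →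
             Σ Literal λ x → x ∈ₑ P × neg x ≡ δ
  lands-on {P} cover ¬β∉P (x , x∈P , ¬x∈D) with cover ¬x∈D
  ... | inj₁ ¬x≡β = ⊥-elim (¬β∉P (subst (_∈ₑ P) (neg-flip ¬x≡β) x∈P))
  ... | inj₂ ¬x≡δ = x , x∈P , ¬x≡δ

  -- Writing R = {β , d} and
  -- T = {β , ¬d}, the clashes of P with R and with T land through endpoints
  -- x , y of P with ¬x = d and ¬y = ¬d; these share a variable, so x = y and
  -- then d = ¬d.
  no-two-pairs : ∀ {α β P Q R T} → var α ≢ var β →
                 α ∈ₑ P → α ∈ₑ Q → β ∈ₑ R → β ∈ₑ T → ¬ β ∈ₑ Q →
                 Clash P Q → Clash R T → Clash P R → Clash P T → ⊥
  no-two-pairs {β = β} {P} {Q} {T = T} α≁β α∈P α∈Q β∈R β∈T β∉Q P×Q R×T P×R P×T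
    with other-endpoint β∈R
  ... | d , d∈R , β≁d =
    same-landing (lands-on (covered-by β∈R d∈R β≁d) ¬β∉P P×R)
                 (lands-on (covered-by β∈T ¬d∈T β≁d) ¬β∉P P×T)
    where
      ¬d∈T : neg d ∈ₑ T
      ¬d∈T = shared-endpoint β∈R β∈T R×T d∈R β≁d

      -- ¬β ∉ P, since otherwise ¬β would be P's other endpoint and β ∈ Q.
      ¬β∉P : ¬ neg β ∈ₑ P
      ¬β∉P ¬β∈P = β∉Q (subst (_∈ₑ Q) (neg-involutive β)
                                (shared-endpoint α∈P α∈Q P×Q ¬β∈P α≁β))

      same-landing : (Σ Literal λ x → x ∈ₑ P × neg x ≡ d) →
                     (Σ Literal λ y → y ∈ₑ P × neg y ≡ neg d) → ⊥
      same-landing (x , x∈P , refl) (y , y∈P , ¬y≡¬¬x) =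
        neg-irreflexive x (sym (trans (endpoint-by-var x∈P y∈P (cong var (sym y≡¬x))) y≡¬x))
        where
          y≡¬x : y ≡ neg x
          y≡¬x = trans (neg-flip ¬y≡¬¬x) (neg-involutive (neg x))

  -- Four edges through α or β, one of them through α, cannot be pairwise
  -- conflicting: either three share a literal or two go through each.
  no-four-around : ∀ {α β e₂ e₃ e₄ e₅} → var α ≢ var β → α ∈ₑ e₂ →
                   α ∈ₑ e₃ ⊎ β ∈ₑ e₃ → α ∈ₑ e₄ ⊎ β ∈ₑ e₄ → α ∈ₑ e₅ ⊎ β ∈ₑ e₅ →
                   Conflict e₂ e₃ → Conflict e₂ e₄ → Conflict e₂ e₅ →
                   Conflict e₃ e₄ → Conflict e₃ e₅ → Conflict e₄ e₅ → ⊥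
  no-four-around α≁β α₂ (inj₁ α₃) (inj₁ α₄) _ c₂₃ c₂₄ c₂₅ c₃₄ c₃₅ c₄₅ =
    no-three-through α₂ α₃ α₄ (clash c₂₃) (clash c₂₄) (distinct c₃₄)
  no-four-around α≁β α₂ (inj₁ α₃) (inj₂ β₄) (inj₁ α₅) c₂₃ c₂₄ c₂₅ c₃₄ c₃₅ c₄₅ =
    no-three-through α₂ α₃ α₅ (clash c₂₃) (clash c₂₅) (distinct c₃₅)
  no-four-around α≁β α₂ (inj₂ β₃) (inj₁ α₄) (inj₁ α₅) c₂₃ c₂₄ c₂₅ c₃₄ c₃₅ c₄₅ =
    no-three-through α₂ α₄ α₅ (clash c₂₄) (clash c₂₅) (distinct c₄₅)
  no-four-around α≁β α₂ (inj₂ β₃) (inj₂ β₄) (inj₂ β₅) c₂₃ c₂₄ c₂₅ c₃₄ c₃₅ c₄₅ =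
    no-three-through β₃ β₄ β₅ (clash c₃₄) (clash c₃₅) (distinct c₄₅)
  no-four-around α≁β α₂ (inj₁ α₃) (inj₂ β₄) (inj₂ β₅) c₂₃ c₂₄ c₂₅ c₃₄ c₃₅ c₄₅ =
    no-two-pairs α≁β α₂ α₃ β₄ β₅
      (λ β₃ → no-three-through β₃ β₄ β₅ (clash c₃₄) (clash c₃₅) (distinct c₄₅))
      (clash c₂₃) (clash c₄₅) (clash c₂₄) (clash c₂₅)
  no-four-around α≁β α₂ (inj₂ β₃) (inj₁ α₄) (inj₂ β₅) c₂₃ c₂₄ c₂₅ c₃₄ c₃₅ c₄₅ =
    no-two-pairs α≁β α₂ α₄ β₃ β₅
      (λ β₄ → no-three-through β₄ β₃ β₅ (clash-sym (clash c₃₄)) (clash c₄₅) (distinct c₃₅))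
      (clash c₂₄) (clash c₃₅) (clash c₂₃) (clash c₂₅)
  no-four-around α≁β α₂ (inj₂ β₃) (inj₂ β₄) (inj₁ α₅) c₂₃ c₂₄ c₂₅ c₃₄ c₃₅ c₄₅ =
    no-two-pairs α≁β α₂ α₅ β₃ β₄
      (λ β₅ → no-three-through β₅ β₃ β₄ (clash-sym (clash c₃₅)) (clash-sym (clash c₄₅)) (distinct c₃₄))
      (clash c₂₅) (clash c₃₄) (clash c₂₃) (clash c₂₄)

  -- No five edges are pairwise conflicting: every other edge clashes with
  -- e₁ = {a , b}, so goes through ¬a or ¬b; orient so that e₂ goes through
  -- the first of them.
  no-five-conflicting : ∀ {e₁ e₂ e₃ e₄ e₅} →
    Conflict e₁ e₂ → Conflict e₁ e₃ → Conflict e₁ e₄ → Conflict e₁ e₅ →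
    Conflict e₂ e₃ → Conflict e₂ e₄ → Conflict e₂ e₅ →
    Conflict e₃ e₄ → Conflict e₃ e₅ → Conflict e₄ e₅ → ⊥
  no-five-conflicting {(a , b) , a≁b} {e₂} {e₃} {e₄} {e₅} c₁₂ c₁₃ c₁₄ c₁₅ c₂₃ c₂₄ c₂₅ c₃₄ c₃₅ c₄₅
    with clash-from e₂ (clash c₁₂)
  ... | inj₁ ¬a₂ =
    no-four-around a≁b ¬a₂ (clash-from e₃ (clash c₁₃)) (clash-from e₄ (clash c₁₄))
      (clash-from e₅ (clash c₁₅)) c₂₃ c₂₄ c₂₅ c₃₄ c₃₅ c₄₅
  ... | inj₂ ¬b₂ =
    no-four-around (a≁b ∘ sym) ¬b₂ (Sum.swap (clash-from e₃ (clash c₁₃)))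
      (Sum.swap (clash-from e₄ (clash c₁₄))) (Sum.swap (clash-from e₅ (clash c₁₅)))
      c₂₃ c₂₄ c₂₅ c₃₄ c₃₅ c₄₅

  Adjacent : CPEdge → CPEdge → Set
  Adjacent = _~_ (Ke (cp n))

  Independent : CPEdge → CPEdge → Set
  Independent C D = ¬ Same C D × ¬ Adjacent C D

  from-ends : ∀ {u v u' v' x} {u≁v : var u ≢ var v} {u'≁v' : var u' ≢ var v'} →
              x ∈ (u ∷ v ∷ u' ∷ v' ∷ []) →
              x ∈ₑ ((u , v) , u≁v) ⊎ x ∈ₑ ((u' , v') , u'≁v')
  from-ends (here refl) = inj₁ first
  from-ends (there (here refl)) = inj₁ second
  from-ends (there (there (here refl))) = inj₂ first
  from-ends (there (there (there (here refl)))) = inj₂ second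

  to-ends : ∀ {u v u' v' x} {u≁v : var u ≢ var v} {u'≁v' : var u' ≢ var v'} →
            x ∈ₑ ((u , v) , u≁v) ⊎ x ∈ₑ ((u' , v') , u'≁v') →
            x ∈ (u ∷ v ∷ u' ∷ v' ∷ [])
  to-ends (inj₁ first) = here refl
  to-ends (inj₁ second) = there (here refl)
  to-ends (inj₂ first) = there (there (here refl))
  to-ends (inj₂ second) = there (there (there (here refl)))

  -- A literal and its complement never span an edge of cp(n).
  clash⇒non-adjacent : ∀ C D → Clash C D → ¬ Adjacent C D
  clash⇒non-adjacent ((_ , _) , C-edge) ((_ , _) , D-edge) (x , x∈C , ¬x∈D) (_ , clique) =
    clique (to-ends {u'≁v' = D-edge} (inj₁ x∈C)) (to-ends {u≁v = C-edge} (inj₂ ¬x∈D))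
           (neg-irreflexive x ∘ sym) refl

  -- Without a clash, two literals of C ∪ D over one variable would be
  -- complementary endpoints of a single edge; so C ∪ D is a clique.
  no-clash⇒clique : ∀ {u v u' v'} {u≁v : var u ≢ var v} {u'≁v' : var u' ≢ var v'} →
                    ¬ Clash ((u , v) , u≁v) ((u' , v') , u'≁v') →
                    IsComplete (cp n) (u ∷ v ∷ u' ∷ v' ∷ [])
  no-clash⇒clique ¬clash x∈ y∈ x≢y x≈y =
    complementary (from-ends x∈) (from-ends y∈) (same-var _ _ x≈y x≢y)
    where
      complementary : ∀ {x y} → _ ⊎ _ → _ ⊎ _ → y ≡ neg x → ⊥
      complementary (inj₁ x∈C) (inj₁ ¬x∈C) refl = no-complementary-endpoints x∈C ¬x∈C
      complementary (inj₂ x∈D) (inj₂ ¬x∈D) refl = no-complementary-endpoints x∈D ¬x∈D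
      complementary {x} (inj₁ x∈C) (inj₂ ¬x∈D) refl = ¬clash (x , x∈C , ¬x∈D)
      complementary {x} (inj₂ x∈D) (inj₁ ¬x∈C) refl = ¬clash (clash-sym (x , x∈D , ¬x∈C))

  conflict⇒independent : ∀ C D → Conflict C D → Independent C D
  conflict⇒independent C D c = distinct c , clash⇒non-adjacent C D (clash c)

  independent⇒conflict : ∀ C D → Independent C D → Conflict C D
  independent⇒conflict C@((_ , _) , _) D@((_ , _) , _) (C≠D , non-adjacent) with clash? C D
  ... | yes C×D = record { distinct = C≠D ; clash = C×D }
  ... | no ¬C×D = ⊥-elim (non-adjacent (C≠D , no-clash⇒clique ¬C×D))

  independent-set-size≤4 : ∀ S → IndependentSet (Ke (cp n)) S → length S ≤ 4
  independent-set-size≤4 [] _ = z≤n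
  independent-set-size≤4 (_ ∷ []) _ = s≤s z≤n
  independent-set-size≤4 (_ ∷ _ ∷ []) _ = s≤s (s≤s z≤n)
  independent-set-size≤4 (_ ∷ _ ∷ _ ∷ []) _ = s≤s (s≤s (s≤s z≤n))
  independent-set-size≤4 (_ ∷ _ ∷ _ ∷ _ ∷ []) _ = s≤s (s≤s (s≤s (s≤s z≤n)))
  independent-set-size≤4 (e₁ ∷ e₂ ∷ e₃ ∷ e₄ ∷ e₅ ∷ _)
    ((i₁₂ ∷ i₁₃ ∷ i₁₄ ∷ i₁₅ ∷ _) ∷ (i₂₃ ∷ i₂₄ ∷ i₂₅ ∷ _) ∷ (i₃₄ ∷ i₃₅ ∷ _) ∷ (i₄₅ ∷ _) ∷ _) =
    ⊥-elim (no-five-conflicting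
      (independent⇒conflict e₁ e₂ i₁₂) (independent⇒conflict e₁ e₃ i₁₃)
      (independent⇒conflict e₁ e₄ i₁₄) (independent⇒conflict e₁ e₅ i₁₅)
      (independent⇒conflict e₂ e₃ i₂₃) (independent⇒conflict e₂ e₄ i₂₄)
      (independent⇒conflict e₂ e₅ i₂₅) (independent⇒conflict e₃ e₄ i₃₄)
      (independent⇒conflict e₃ e₅ i₃₅) (independent⇒conflict e₄ e₅ i₄₅))

  square : ∀ {i j} → i ≢ j → Bool → Bool → CPEdge
  square {i} {j} i≢j s t = ((i , s) , (j , t)) , i≢j

  square-conflict : ∀ {i j} (i≢j : i ≢ j) {s t s' t'} → s ≢ s' ⊎ t ≢ t' →
                    Conflict (square i≢j s t) (square i≢j s' t')
  square-conflict {i} {j} i≢j {s} {t} {s'} {t'} differ =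
    record { distinct = not-same ; clash = clash-on differ }
    where
      not-same : ¬ Same (square i≢j s t) (square i≢j s' t')
      not-same (inj₁ (refl , refl)) = Sum.[ (λ s≢s → s≢s refl) , (λ t≢t → t≢t refl) ] differ
      not-same (inj₂ (i,s≡j,t' , _)) = i≢j (cong var i,s≡j,t')

      clash-on : s ≢ s' ⊎ t ≢ t' → Clash (square i≢j s t) (square i≢j s' t')
      clash-on (inj₁ s≢s') with Bool.¬-not (s≢s' ∘ sym)
      ... | refl = (i , s) , first , first
      clash-on (inj₂ t≢t') with Bool.¬-not (t≢t' ∘ sym)
      ... | refl = (j , t) , second , second

  squares : ∀ {i j} → i ≢ j → List CPEdge
  squares i≢j = square i≢j true true ∷ square i≢j true false
              ∷ square i≢j false true ∷ square i≢j false false ∷ []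

  squares-independent : ∀ {i j} (i≢j : i ≢ j) → IndependentSet (Ke (cp n)) (squares i≢j)
  squares-independent i≢j =
      (independent (inj₂ λ ()) ∷ independent (inj₁ λ ()) ∷ independent (inj₁ λ ()) ∷ [])
    ∷ (independent (inj₁ λ ()) ∷ independent (inj₁ λ ()) ∷ [])
    ∷ (independent (inj₂ λ ()) ∷ [])
    ∷ [] ∷ []
    where
      independent : ∀ {s t s' t'} → s ≢ s' ⊎ t ≢ t' →
                    Independent (square i≢j s t) (square i≢j s' t')
      independent differ = conflict⇒independent _ _ (square-conflict i≢j differ)

mainTheorem1 : ∀ (n : ℕ) → 2 ≤ n → IndependenceNumberIs (Ke (cp n)) 4
mainTheorem1 (suc (suc m)) (s≤s (s≤s z≤n)) =
  (squares x₀≢x₁ , squares-independent x₀≢x₁ , refl) , independent-set-size≤4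
  where
    open CocktailParty (suc (suc m))

    x₀≢x₁ : zero ≢ suc zero
    x₀≢x₁ ()
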